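{- Let $\varepsilon>0$, $k\ge k_0(\varepsilon)$ and $m=dn/2$ with $d\le(2-\varepsilon)k\ln k$. There is a constant $\rho>0$ such that, if $\sigma\in\{1,\dots,k\}^n$ is chosen uniformly at random, then $\Pr[|G(\sigma)|\ge\rho\lambda]\ge\rho$.
   Context: For $\sigma\in\{1,\dots,k\}^n$, $G(\sigma)$ denotes the set of all graphs on vertex set $\{1,\dots,n\}$ with exactly $m$ edges for which $\sigma$ is a proper coloring (every edge joins vertices with different colors under $\sigma$). $\lambda=\max_{\sigma\in\{1,\dots,k\}^n}|G(\sigma)|$.
   Formalization: The parameter ε ranges over the positive rationals and d over the non-negative rationals, with $m$ taken as ⌊dn/2⌋. -}

module Defs where

open import Data.Nat using (ℕ; zero; suc; _+_; _*_; _^_; _≤_; _<_; _≤ᵇ_; _<ᵇ_; _≡ᵇ_; _⊔_; _/_)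
open import Data.Nat using (_!)
open import Data.Bool using (Bool; true; false; not; _∧_; if_then_else_)
open import Data.Fin using (Fin; toℕ)
import Data.Fin as Fin
open import Data.List using (List; []; _∷_; length; map; foldr; concatMap; filterᵇ; allFin)
open import Data.Bool.ListAction using (and)
open import Data.Vec using (Vec; []; _∷_; lookup)
open import Data.Product using (_×_; _,_)
open import Data.Sum using (_⊎_)
open import Relation.Nullary using (does)
open import Relation.Binary.PropositionalEquality using (_≡_)

allPairs : (n : ℕ) → List (Fin n × Fin n)
allPairs n = concatMap (λ i → concatMap (λ j → if toℕ i <ᵇ toℕ j then (i , j) ∷ [] else []) (allFin n)) (allFin n)

-- A graph on {1,…,n}: an indicator vector saying which possible edges are present.
Graph : ℕ → Set
Graph n = Vec Bool (length (allPairs n))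

selected : {A : Set} → (l : List A) → Vec Bool (length l) → List A
selected [] [] = []
selected (x ∷ l) (true ∷ v) = x ∷ selected l v
selected (x ∷ l) (false ∷ v) = selected l v

edges : {n : ℕ} → Graph n → List (Fin n × Fin n)
edges {n} g = selected (allPairs n) g

allVecs : {A : Set} → List A → (N : ℕ) → List (Vec A N)
allVecs xs zero = [] ∷ []
allVecs xs (suc N) = concatMap (λ x → map (x ∷_) (allVecs xs N)) xs

allGraphs : (n : ℕ) → List (Graph n)
allGraphs n = allVecs (true ∷ false ∷ []) (length (allPairs n))

Coloring : ℕ → ℕ → Set
Coloring n k = Vec (Fin k) n

allColorings : (n k : ℕ) → List (Coloring n k)
allColorings n k = allVecs (allFin k) n

isProper : {n k : ℕ} → Coloring n k → Graph n → Bool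
isProper {n} σ g = and (map (λ { (i , j) → not (does (lookup σ i Fin.≟ lookup σ j)) }) (edges {n} g))

G : (n m : ℕ) {k : ℕ} → Coloring n k → List (Graph n)
G n m σ = filterᵇ (λ g → (length (edges {n} g) ≡ᵇ m) ∧ isProper σ g) (allGraphs n)

Λ : (n k m : ℕ) → ℕ
Λ n k m = foldr _⊔_ 0 (map (λ σ → length (G n m σ)) (allColorings n k))

goodCount : (n k m r s : ℕ) → ℕ
goodCount n k m r s =
  length (filterᵇ (λ σ → (r * Λ n k m) ≤ᵇ (s * length (G n m σ))) (allColorings n k))

-- Exponential comparison: e^X ≤ M  (X, M natural numbers).
-- expNum X N = N! * Σ_{j=0}^{N} X^j / j!  (an integer).
expNum : ℕ → ℕ → ℕ
expNum X zero = 1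
expNum X (suc N) = suc N * expNum X N + X ^ suc N

-- e^X ≤ M  iff every partial sum of the exponential series is ≤ M.
ExpLe : ℕ → ℕ → Set
ExpLe X M = (N : ℕ) → expNum X N ≤ M * (N !)

-- With ε = a/b and d = p/q (rationals, b,q ≥ 1, k ≥ 1):
--   d ≤ (2 - ε) k ln k.
-- If a ≤ 2b this is  p b ≤ (2b-a) q k ln k  ⇔  e^{p b} ≤ k^{(2b-a) q k}.
-- If a > 2b the right side is negative unless k = 1 (then 0), so d ≤ rhs ⇔ p = 0 and k = 1.
DegreeBound : (a b p q k : ℕ) → Set
DegreeBound a b p q k with a ≤ᵇ 2 * b
... | true  = ExpLe (p * b) (k ^ ((2 * b Data.Nat.∸ a) * q * k))
... | false = (p ≡ 0) × (k ≡ 1)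

-- m = ⌊d n / 2⌋ for d = p/q (q ≥ 1 is assumed in the statement; q = 0 is a dummy case)
edgeCount : (p q n : ℕ) → ℕ
edgeCount p zero n = 0
edgeCount p (suc q) n = (p * n) / (2 * suc q)

module Submission where

-- |G(σ)| is the binomial coefficient C(F(σ), m), where F(σ) counts the
-- bichromatic pairs. With Q(σ) the sum of the squared colour-class sizes,
-- 2F + Q = n², and Cauchy–Schwarz gives n² ≤ kQ, so 2kF ≤ (k-1)n² for every
-- σ. The excess kQ - n² has mean n(k-1) over uniform σ, so by Markov at least
-- half of all colourings are balanced (excess < 2n(k-1)); a balanced σ has
-- F(τ) < F(σ) + n for every τ and F(σ) ≥ (k-1)n²/2k - n. As m ≤ pn is small
-- against F(σ), adding fewer than n pairs multiplies C(F(σ), m) by at most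
-- 2^(2d), d = 8(p+1): split them into 2d blocks of ⌊n/d⌋ pairs and apply
-- Bernoulli's inequality to each. So ρ = 1/(2^(2d) k^d) works, the factor k^d
-- covering n < d, where a single maximiser of |G| is enough.

open import Data.Bool using (Bool; true; false; not; _∧_; T; if_then_else_)
open import Data.Bool.ListAction using (and)
open import Data.Bool.Properties using (∧-zeroʳ)
open import Data.Fin using (Fin; zero; suc; toℕ; _≟_)
open import Data.List using (List; []; _∷_; length; map; _++_; filterᵇ; concatMap; tabulate; allFin)
open import Data.List.Membership.Propositional using (_∈_)
open import Data.List.Membership.Propositional.Properties using (foldr-selective; ∈-map⁻)
open import Data.List.Properties using (length-++; filter-++; map-++; ++-identityʳ; map-cong; map-∘)
open import Data.List.Relation.Unary.Any using (here; there)
open import Data.Nat hiding (_≟_)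
open import Data.Nat.Combinatorics using (_C_; nC1≡n; nCk+nC[k+1]≡[n+1]C[k+1])
open import Data.Nat.DivMod using (m≡m%n+[m/n]*n; m%n<n; m≥n⇒m/n>0; m/n≤m; m/n*n≤m)
open import Data.Nat.ListAction using (sum)
open import Data.Nat.ListAction.Properties using (sum-++)
open import Data.Nat.Properties hiding (_≟_)
open import Data.Nat.Tactic.RingSolver using (solve-∀)
open import Data.Product using (Σ; _×_; _,_)
open import Data.Sum using (inj₁; inj₂)
open import Data.Vec using (Vec; []; _∷_; lookup)
open import Function using (_∘_)
open import Relation.Binary.PropositionalEquality using (_≡_; refl; sym; trans; cong; cong₂; subst; module ≡-Reasoning)
open import Relation.Nullary using (yes; no; does; contradiction; ofʸ; ofⁿ)
open import Relation.Nullary.Decidable using (T?)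

open import Algebra.Properties.CommutativeSemigroup *-commutativeSemigroup
  using (x∙yz≈y∙xz; xy∙z≈y∙xz) renaming (interchange to *-interchange)
open import Algebra.Properties.CommutativeSemigroup +-commutativeSemigroup
  using () renaming (interchange to +-interchange)
open import Algebra.Properties.Semiring.Sum +-*-semiring
  using (sum-syntax; sum-cong-≗; ∑-distrib-+; *-distribˡ-sum)

open import Defs

-- Arithmetic

not-≤ᵇ⇒> : ∀ {m n} → T (not (m ≤ᵇ n)) → n < m
not-≤ᵇ⇒> {m} {n} t with m ≤ᵇ n | ≤ᵇ-reflects-≤ m n
... | false | ofⁿ m≰n = ≰⇒> m≰n

m≤2*[m/n]*n : ∀ m n .{{_ : NonZero n}} → n ≤ m → m ≤ 2 * (m / n) * n
m≤2*[m/n]*n m n n≤m = begin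
    m                              ≡⟨ m≡m%n+[m/n]*n m n ⟩
    m % n + m / n * n              ≤⟨ +-monoˡ-≤ (m / n * n) (<⇒≤ (m%n<n m n)) ⟩
    n + m / n * n                  ≤⟨ +-monoˡ-≤ (m / n * n) (m≤n*m n (m / n) {{>-nonZero (m≥n⇒m/n>0 n≤m)}}) ⟩
    m / n * n + m / n * n          ≡⟨ cong (m / n * n +_) (sym (+-identityʳ _)) ⟩
    2 * (m / n * n)                ≡⟨ sym (*-assoc 2 (m / n) n) ⟩
    2 * (m / n) * n                ∎
  where open ≤-Reasoning

2ab≤a²+b² : ∀ a b → 2 * (a * b) ≤ a * a + b * b
2ab≤a²+b² a b with ≤-total a b
... | inj₁ a≤b = subst (λ b → 2 * (a * b) ≤ a * a + b * b) (m+[n∸m]≡n a≤b)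
                   (subst (2 * (a * (a + (b ∸ a))) ≤_) (square a (b ∸ a)) (m≤m+n _ _))
  where
  square : ∀ a d → 2 * (a * (a + d)) + d * d ≡ a * a + (a + d) * (a + d)
  square = solve-∀
... | inj₂ b≤a = subst (λ a → 2 * (a * b) ≤ a * a + b * b) (m+[n∸m]≡n b≤a)
                   (subst (2 * ((b + (a ∸ b)) * b) ≤_) (square b (a ∸ b)) (m≤m+n _ _))
  where
  square : ∀ b d → 2 * ((b + d) * b) + d * d ≡ (b + d) * (b + d) + b * b
  square = solve-∀

-- Finite sums

∑-const : ∀ n a → ∑[ i < n ] a ≡ n * a
∑-const zero a = refl
∑-const (suc n) a = cong (a +_) (∑-const n a)

∑-mono : ∀ {n} {f g : Fin n → ℕ} → (∀ i → f i ≤ g i) → ∑[ i < n ] f i ≤ ∑[ i < n ] g i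
∑-mono {zero} f≤g = z≤n
∑-mono {suc n} f≤g = +-mono-≤ (f≤g zero) (∑-mono (f≤g ∘ suc))

cauchy-schwarz : ∀ {k} (f : Fin k → ℕ) → ∑[ c < k ] f c * ∑[ c < k ] f c ≤ k * ∑[ c < k ] (f c * f c)
cauchy-schwarz {k} f = *-cancelˡ-≤ 2 (begin
    2 * (S * S)
  ≡⟨ cong (2 *_) (*-distribˡ-sum S f) ⟩
    2 * ∑[ c < k ] (S * f c)
  ≡⟨ *-distribˡ-sum 2 (λ c → S * f c) ⟩
    ∑[ c < k ] (2 * (S * f c))
  ≡⟨ sum-cong-≗ {k} (λ c → cong (2 *_) (trans (*-comm S (f c)) (*-distribˡ-sum (f c) f))) ⟩
    ∑[ c < k ] (2 * ∑[ d < k ] (f c * f d))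
  ≡⟨ sum-cong-≗ {k} (λ c → *-distribˡ-sum 2 (λ d → f c * f d)) ⟩
    ∑[ c < k ] ∑[ d < k ] (2 * (f c * f d))
  ≤⟨ ∑-mono (λ c → ∑-mono (λ d → 2ab≤a²+b² (f c) (f d))) ⟩
    ∑[ c < k ] ∑[ d < k ] (f c * f c + f d * f d)
  ≡⟨ sum-cong-≗ {k} (λ c → trans (∑-distrib-+ (λ _ → f c * f c) (λ d → f d * f d)) (cong (_+ Q) (∑-const k (f c * f c)))) ⟩
    ∑[ c < k ] (k * (f c * f c) + Q)
  ≡⟨ ∑-distrib-+ (λ c → k * (f c * f c)) (λ _ → Q) ⟩
    ∑[ c < k ] (k * (f c * f c)) + ∑[ c < k ] Q
  ≡⟨ cong₂ _+_ (sym (*-distribˡ-sum k (λ c → f c * f c))) (∑-const k Q) ⟩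
    k * Q + k * Q
  ≡⟨ cong (k * Q +_) (sym (+-identityʳ (k * Q))) ⟩
    2 * (k * Q)
  ∎)
  where
  open ≤-Reasoning
  S = ∑[ c < k ] f c
  Q = ∑[ c < k ] (f c * f c)

⟦_⟧ : Bool → ℕ
⟦ true ⟧ = 1
⟦ false ⟧ = 0

δ : ∀ {k} → Fin k → Fin k → ℕ
δ c d = ⟦ does (c ≟ d) ⟧

∑-δ-* : ∀ {k} d (f : Fin k → ℕ) → ∑[ c < k ] (δ d c * f c) ≡ f d
∑-δ-* {suc k} zero f = trans (cong (f zero + 0 +_) (trans (∑-const k 0) (*-zeroʳ k))) (trans (+-identityʳ _) (+-identityʳ _))
∑-δ-* {suc k} (suc d) f = trans (sum-cong-≗ {k} (λ c → cong (λ b → ⟦ b ⟧ * f (suc c)) (does-suc d c))) (∑-δ-* d (f ∘ suc))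
  where
  does-suc : ∀ {k} (d c : Fin k) → does (suc d ≟ suc c) ≡ does (d ≟ c)
  does-suc d c with d ≟ c
  ... | yes refl = refl
  ... | no _     = refl

∑-δ : ∀ {k} d → ∑[ c < k ] δ d c ≡ 1
∑-δ {k} d = trans (sum-cong-≗ {k} (λ c → sym (*-identityʳ (δ d c)))) (∑-δ-* d (λ _ → 1))

δ-idem : ∀ {k} (c d : Fin k) → δ c d * δ c d ≡ δ c d
δ-idem c d with does (c ≟ d)
... | true  = refl
... | false = refl

≢-indicator+δ : ∀ {k} (c d : Fin k) → ⟦ not (does (c ≟ d)) ⟧ + δ d c ≡ 1
≢-indicator+δ c d with c ≟ d | d ≟ c
... | yes _   | yes _   = refl
... | yes c≡d | no  d≢c = contradiction (sym c≡d) d≢c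
... | no  c≢d | yes d≡c = contradiction (sym d≡c) c≢d
... | no  _   | no  _   = refl

-- Binomial coefficients

pascal : ∀ n k → suc n C suc k ≡ n C k + n C suc k
pascal n k = sym (nCk+nC[k+1]≡[n+1]C[k+1] n k)

C-monoˡ : ∀ {n n′} m → n ≤ n′ → n C m ≤ n′ C m
C-monoˡ {n} m n≤n′ = subst (λ x → n C m ≤ x C m) (m+[n∸m]≡n n≤n′) (go _)
  where
  step : ∀ x m → x C m ≤ suc x C m
  step x zero = ≤-refl
  step x (suc m) = ≤-trans (m≤n+m (x C suc m) (x C m)) (≤-reflexive (sym (pascal x m)))
  go : ∀ t → n C m ≤ (n + t) C m
  go zero = ≤-reflexive (cong (_C m) (sym (+-identityʳ n)))
  go (suc t) = subst (λ x → n C m ≤ x C m) (sym (+-suc n t)) (≤-trans (go t) (step (n + t) m))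

C-absorb : ∀ n m → suc m * (suc n C suc m) ≡ suc n * (n C m)
C-absorb zero zero = refl
C-absorb zero (suc m) = *-zeroʳ (suc (suc m))
C-absorb (suc n) zero = trans (*-identityˡ _) (trans (nC1≡n (suc (suc n))) (sym (*-identityʳ _)))
C-absorb (suc n) (suc m) = begin
    suc (suc m) * (suc (suc n) C suc (suc m))
  ≡⟨ cong (suc (suc m) *_) (pascal (suc n) (suc m)) ⟩
    suc (suc m) * (a + b)
  ≡⟨ regroup (suc m) a b ⟩
    a + suc m * a + suc (suc m) * b
  ≡⟨ cong₂ (λ x y → a + x + y) (C-absorb n m) (C-absorb n (suc m)) ⟩
    a + suc n * (n C m) + suc n * (n C suc m)
  ≡⟨ collect a (suc n) (n C m) (n C suc m) ⟩
    a + suc n * (n C m + n C suc m)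
  ≡⟨ cong (λ x → a + suc n * x) (sym (pascal n m)) ⟩
    suc (suc n) * a
  ∎
  where
  open ≡-Reasoning
  a = suc n C suc m
  b = suc n C suc (suc m)
  regroup : ∀ m a b → suc m * (a + b) ≡ a + m * a + suc m * b
  regroup = solve-∀
  collect : ∀ a n x y → a + n * x + n * y ≡ a + n * (x + y)
  collect = solve-∀

C-suc-ratio : ∀ Y m W → W ≤ suc Y → (suc Y C m) * (W ∸ m) ≤ (Y C m) * W
C-suc-ratio Y zero W _ = ≤-refl
C-suc-ratio Y (suc m) W W≤1+Y with W ≤? m
... | yes W≤m = ≤-trans (≤-reflexive vanish) z≤n
  where
  vanish : (suc Y C suc m) * (W ∸ suc m) ≡ 0
  vanish = trans (cong ((suc Y C suc m) *_) (m≤n⇒m∸n≡0 (m≤n⇒m≤1+n W≤m))) (*-zeroʳ (suc Y C suc m))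
... | no W≰m = +-cancelʳ-≤ (c * suc m) _ _ (begin
    c * (W ∸ suc m) + c * suc m
  ≡⟨ sym (*-distribˡ-+ c (W ∸ suc m) (suc m)) ⟩
    c * (W ∸ suc m + suc m)
  ≡⟨ cong (c *_) (m∸n+n≡m (≰⇒> W≰m)) ⟩
    c * W
  ≡⟨ trans (cong (_* W) (pascal Y m)) (*-distribʳ-+ W a b) ⟩
    a * W + b * W
  ≤⟨ +-monoˡ-≤ (b * W) aW≤ ⟩
    suc m * c + b * W
  ≡⟨ trans (+-comm (suc m * c) (b * W)) (cong (b * W +_) (*-comm (suc m) c)) ⟩
    b * W + c * suc m
  ∎)
  where
  open ≤-Reasoning
  a = Y C m
  b = Y C suc m
  c = suc Y C suc m
  aW≤ : a * W ≤ suc m * c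
  aW≤ = begin
      a * W      ≤⟨ *-monoʳ-≤ a W≤1+Y ⟩
      a * suc Y  ≡⟨ *-comm a (suc Y) ⟩
      suc Y * a  ≡⟨ sym (C-absorb Y m) ⟩
      suc m * c  ∎

C-+-ratio : ∀ t Y m → ((Y + t) C m) * (Y ∸ m) ^ t ≤ (Y C m) * Y ^ t
C-+-ratio zero Y m = ≤-reflexive (cong (λ x → (x C m) * 1) (+-identityʳ Y))
C-+-ratio (suc t) Y m = begin
    ((Y + suc t) C m) * ((Y ∸ m) * (Y ∸ m) ^ t)
  ≡⟨ cong (λ x → (x C m) * ((Y ∸ m) * (Y ∸ m) ^ t)) (+-suc Y t) ⟩
    ((suc (Y + t)) C m) * ((Y ∸ m) * (Y ∸ m) ^ t)
  ≡⟨ sym (*-assoc (suc (Y + t) C m) (Y ∸ m) _) ⟩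
    ((suc (Y + t)) C m) * (Y ∸ m) * (Y ∸ m) ^ t
  ≤⟨ *-monoˡ-≤ ((Y ∸ m) ^ t) (C-suc-ratio (Y + t) m Y (m≤n⇒m≤1+n (m≤m+n Y t))) ⟩
    ((Y + t) C m) * Y * (Y ∸ m) ^ t
  ≡⟨ xy∙z≈y∙xz ((Y + t) C m) Y ((Y ∸ m) ^ t) ⟩
    Y * (((Y + t) C m) * (Y ∸ m) ^ t)
  ≤⟨ *-monoʳ-≤ Y (C-+-ratio t Y m) ⟩
    Y * ((Y C m) * Y ^ t)
  ≡⟨ x∙yz≈y∙xz Y (Y C m) (Y ^ t) ⟩
    (Y C m) * (Y * Y ^ t)
  ∎
  where
  open ≤-Reasoning

^-bernoulli : ∀ t W m → m * t ≤ W → W ^ t * (W ∸ m * t) ≤ (W ∸ m) ^ t * W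
^-bernoulli zero W m _ = ≤-reflexive (cong (λ x → 1 * (W ∸ x)) (*-zeroʳ m))
^-bernoulli (suc t) W m mt′≤W = begin
    W * W ^ t * (W ∸ m * suc t)
  ≡⟨ cong (λ x → W * W ^ t * (W ∸ x)) (*-suc m t) ⟩
    W * W ^ t * c
  ≡⟨ xy∙z≈y∙xz W (W ^ t) c ⟩
    W ^ t * (W * c)
  ≤⟨ *-monoʳ-≤ (W ^ t) key ⟩
    W ^ t * ((W ∸ m) * (W ∸ m * t))
  ≡⟨ x∙yz≈y∙xz (W ^ t) (W ∸ m) (W ∸ m * t) ⟩
    (W ∸ m) * (W ^ t * (W ∸ m * t))
  ≤⟨ *-monoʳ-≤ (W ∸ m) (^-bernoulli t W m mt≤W) ⟩
    (W ∸ m) * ((W ∸ m) ^ t * W)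
  ≡⟨ sym (*-assoc (W ∸ m) _ W) ⟩
    (W ∸ m) * (W ∸ m) ^ t * W
  ∎
  where
  open ≤-Reasoning
  c = W ∸ (m + m * t)
  W≡ : m + m * t + c ≡ W
  W≡ = m+[n∸m]≡n (subst (_≤ W) (*-suc m t) mt′≤W)
  mt≤W : m * t ≤ W
  mt≤W = ≤-trans (m≤n+m (m * t) m) (subst (_≤ W) (*-suc m t) mt′≤W)
  W∸m≡ : W ∸ m ≡ m * t + c
  W∸m≡ = trans (cong (_∸ m) (trans (sym W≡) (+-assoc m (m * t) c))) (m+n∸m≡n m (m * t + c))
  W∸mt≡ : W ∸ m * t ≡ m + c
  W∸mt≡ = trans (cong (_∸ m * t) (trans (sym W≡) (cong (_+ c) (+-comm m (m * t)))))
                (trans (cong (_∸ m * t) (+-assoc (m * t) m c)) (m+n∸m≡n (m * t) (m + c)))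
  key : W * c ≤ (W ∸ m) * (W ∸ m * t)
  key = begin
      W * c                               ≡⟨ cong (_* c) (sym W≡) ⟩
      (m + m * t + c) * c                 ≤⟨ m≤m+n _ (m * (m * t)) ⟩
      (m + m * t + c) * c + m * (m * t)   ≡⟨ expand m (m * t) c ⟩
      (m * t + c) * (m + c)               ≡⟨ sym (cong₂ _*_ W∸m≡ W∸mt≡) ⟩
      (W ∸ m) * (W ∸ m * t)               ∎
    where
    expand : ∀ a b c → (a + b + c) * c + a * b ≡ (b + c) * (a + c)
    expand = solve-∀

^-halving : ∀ t W m → 2 * (m * t) ≤ W → W ^ t ≤ 2 * (W ∸ m) ^ t
^-halving zero W m _ = s≤s z≤n
^-halving (suc t) zero m _ = z≤n
^-halving (suc t) W@(suc _) m 2mt≤W = *-cancelʳ-≤ _ _ W (begin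
    W ^ suc t * W
  ≤⟨ *-monoʳ-≤ (W ^ suc t) W≤2[W∸mt] ⟩
    W ^ suc t * (2 * (W ∸ m * suc t))
  ≡⟨ x∙yz≈y∙xz (W ^ suc t) 2 (W ∸ m * suc t) ⟩
    2 * (W ^ suc t * (W ∸ m * suc t))
  ≤⟨ *-monoʳ-≤ 2 (^-bernoulli (suc t) W m mt≤W) ⟩
    2 * ((W ∸ m) ^ suc t * W)
  ≡⟨ sym (*-assoc 2 ((W ∸ m) ^ suc t) W) ⟩
    2 * (W ∸ m) ^ suc t * W
  ∎)
  where
  open ≤-Reasoning
  mt = m * suc t
  mt+mt≤W : mt + mt ≤ W
  mt+mt≤W = subst (_≤ W) (cong (mt +_) (+-identityʳ mt)) 2mt≤W
  mt≤W : mt ≤ W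
  mt≤W = m+n≤o⇒m≤o mt mt+mt≤W
  W≤2[W∸mt] : W ≤ 2 * (W ∸ mt)
  W≤2[W∸mt] = begin
      W                      ≡⟨ sym (m+[n∸m]≡n mt≤W) ⟩
      mt + (W ∸ mt)          ≤⟨ +-monoˡ-≤ (W ∸ mt) (m+n≤o⇒m≤o∸n mt mt+mt≤W) ⟩
      (W ∸ mt) + (W ∸ mt)    ≡⟨ cong ((W ∸ mt) +_) (sym (+-identityʳ _)) ⟩
      2 * (W ∸ mt)           ∎

^-blocks : ∀ J T t W m → 2 * (m * T) ≤ W → t ≤ J * T → W ^ t ≤ 2 ^ J * (W ∸ m) ^ t
^-blocks zero T zero W m _ _ = s≤s z≤n
^-blocks (suc J) T t W m 2mT≤W t≤JT with t ≤? T
... | yes t≤T = begin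
    W ^ t                      ≤⟨ ^-halving t W m (≤-trans (*-monoʳ-≤ 2 (*-monoʳ-≤ m t≤T)) 2mT≤W) ⟩
    2 * (W ∸ m) ^ t            ≤⟨ *-monoˡ-≤ ((W ∸ m) ^ t) (*-monoʳ-≤ 2 (m^n>0 2 J)) ⟩
    2 * 2 ^ J * (W ∸ m) ^ t    ∎
  where open ≤-Reasoning
... | no t≰T = begin
    W ^ t                                        ≡⟨ cong (W ^_) (sym t≡) ⟩
    W ^ (T + t′)                                 ≡⟨ ^-distribˡ-+-* W T t′ ⟩
    W ^ T * W ^ t′                               ≤⟨ *-mono-≤ (^-halving T W m 2mT≤W) (^-blocks J T t′ W m 2mT≤W t′≤JT) ⟩
    (2 * (W ∸ m) ^ T) * (2 ^ J * (W ∸ m) ^ t′)   ≡⟨ *-interchange 2 ((W ∸ m) ^ T) (2 ^ J) ((W ∸ m) ^ t′) ⟩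
    2 * 2 ^ J * ((W ∸ m) ^ T * (W ∸ m) ^ t′)     ≡⟨ cong (2 * 2 ^ J *_) (sym (^-distribˡ-+-* (W ∸ m) T t′)) ⟩
    2 * 2 ^ J * (W ∸ m) ^ (T + t′)               ≡⟨ cong (λ x → 2 * 2 ^ J * (W ∸ m) ^ x) t≡ ⟩
    2 * 2 ^ J * (W ∸ m) ^ t                      ∎
  where
  open ≤-Reasoning
  t′ = t ∸ T
  t≡ : T + t′ ≡ t
  t≡ = m+[n∸m]≡n (≰⇒≥ t≰T)
  t′≤JT : t′ ≤ J * T
  t′≤JT = +-cancelˡ-≤ T _ _ (subst (_≤ T + J * T) (sym t≡) t≤JT)

C-growth : ∀ J T t Y m → 2 * (m * T) ≤ Y → t ≤ J * T → (Y + t) C m ≤ 2 ^ J * (Y C m)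
C-growth J T zero Y m _ _ = subst (λ x → x C m ≤ 2 ^ J * (Y C m)) (sym (+-identityʳ Y)) (m≤n*m (Y C m) (2 ^ J) {{m^n≢0 2 J}})
C-growth J T (suc t) Y zero _ _ = subst (1 ≤_) (sym (*-identityʳ (2 ^ J))) (m^n>0 2 J)
C-growth J zero (suc t) Y (suc m) _ t≤JT with () ← subst (suc t ≤_) (*-zeroʳ J) t≤JT
C-growth J T@(suc _) t@(suc _) Y m@(suc _) 2mT≤Y t≤JT =
  *-cancelʳ-≤ _ _ ((Y ∸ m) ^ t) {{m^n≢0 (Y ∸ m) t {{>-nonZero Y∸m>0}}}} (begin
    ((Y + t) C m) * (Y ∸ m) ^ t          ≤⟨ C-+-ratio t Y m ⟩
    (Y C m) * Y ^ t                      ≤⟨ *-monoʳ-≤ (Y C m) (^-blocks J T t Y m 2mT≤Y t≤JT) ⟩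
    (Y C m) * (2 ^ J * (Y ∸ m) ^ t)      ≡⟨ sym (*-assoc (Y C m) (2 ^ J) _) ⟩
    (Y C m) * 2 ^ J * (Y ∸ m) ^ t        ≡⟨ cong (_* (Y ∸ m) ^ t) (*-comm (Y C m) (2 ^ J)) ⟩
    2 ^ J * (Y C m) * (Y ∸ m) ^ t        ∎)
  where
  open ≤-Reasoning
  m+m≤Y : m + m ≤ Y
  m+m≤Y = ≤-trans (≤-reflexive (cong (m +_) (sym (+-identityʳ m)))) (≤-trans (*-monoʳ-≤ 2 (m≤m*n m T)) 2mT≤Y)
  Y∸m>0 : Y ∸ m > 0
  Y∸m>0 = ≤-trans (s≤s z≤n) (m+n≤o⇒m≤o∸n m m+m≤Y)

-- Counting

count : {A : Set} → (A → Bool) → List A → ℕ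
count p xs = length (filterᵇ p xs)

module _ {A : Set} where

  count-++ : ∀ (p : A → Bool) xs ys → count p (xs ++ ys) ≡ count p xs + count p ys
  count-++ p xs ys = trans (cong length (filter-++ (T? ∘ p) xs ys)) (length-++ (filterᵇ p xs))

  count-cong : ∀ {p q : A → Bool} → (∀ x → p x ≡ q x) → ∀ xs → count p xs ≡ count q xs
  count-cong p≗q [] = refl
  count-cong {p} {q} p≗q (x ∷ xs) with p x | q x | p≗q x
  ... | true  | true  | _ = cong suc (count-cong p≗q xs)
  ... | false | false | _ = count-cong p≗q xs

  count-map : ∀ {B : Set} (p : B → Bool) (f : A → B) xs → count p (map f xs) ≡ count (p ∘ f) xs
  count-map p f [] = refl
  count-map p f (x ∷ xs) with p (f x)
  ... | true  = cong suc (count-map p f xs)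
  ... | false = count-map p f xs

  count-false : ∀ xs → count {A} (λ _ → false) xs ≡ 0
  count-false [] = refl
  count-false (x ∷ xs) = count-false xs

  count-mono : ∀ {p q : A → Bool} → (∀ x → T (p x) → T (q x)) → ∀ xs → count p xs ≤ count q xs
  count-mono p⇒q [] = z≤n
  count-mono {p} {q} p⇒q (x ∷ xs) with p x | q x | p⇒q x
  ... | true  | true  | _ = s≤s (count-mono p⇒q xs)
  ... | true  | false | p⇒q′ with () ← p⇒q′ _
  ... | false | true  | _ = m≤n⇒m≤1+n (count-mono p⇒q xs)
  ... | false | false | _ = count-mono p⇒q xs

  count+count-not : ∀ (p : A → Bool) xs → count p xs + count (not ∘ p) xs ≡ length xs
  count+count-not p [] = refl
  count+count-not p (x ∷ xs) with p x
  ... | true  = cong suc (count+count-not p xs)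
  ... | false = trans (+-suc _ _) (cong suc (count+count-not p xs))

  count-all : ∀ {p : A → Bool} → (∀ x → T (p x)) → ∀ xs → count p xs ≡ length xs
  count-all all-p [] = refl
  count-all {p} all-p (x ∷ xs) with p x | all-p x
  ... | true | _ = cong suc (count-all all-p xs)

  count-∈ : ∀ {p : A → Bool} {x xs} → x ∈ xs → T (p x) → 1 ≤ count p xs
  count-∈ {p} (here {x = y} refl) py with p y
  ... | true = s≤s z≤n
  count-∈ {p} (there {x = y} x∈xs) px with p y
  ... | true  = s≤s z≤n
  ... | false = count-∈ x∈xs px

  count-singleton : ∀ (p : A → Bool) x → count p (x ∷ []) ≡ ⟦ p x ⟧
  count-singleton p x with p x
  ... | true  = refl
  ... | false = refl

  count-concatMap-allFin : ∀ (p : A → Bool) {n} (g : Fin n → List A) →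
    count p (concatMap g (allFin n)) ≡ ∑[ i < n ] count p (g i)
  count-concatMap-allFin p g = go g (λ i → i)
    where
    go : ∀ {m n} (g : Fin m → List A) (h : Fin n → Fin m) →
      count p (concatMap g (tabulate h)) ≡ ∑[ i < n ] count p (g (h i))
    go {n = zero} g h = refl
    go {n = suc n} g h = trans (count-++ p (g (h zero)) _) (cong (count p (g (h zero)) +_) (go g (h ∘ suc)))

  markov : ∀ (f : A → ℕ) t xs → count (λ x → t ≤ᵇ f x) xs * t ≤ sum (map f xs)
  markov f t [] = z≤n
  markov f t (x ∷ xs) with t ≤ᵇ f x | ≤ᵇ-reflects-≤ t (f x)
  ... | true  | ofʸ t≤fx = +-mono-≤ t≤fx (markov f t xs)
  ... | false | _        = ≤-trans (markov f t xs) (m≤n+m _ (f x))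

  sum-map-++ : ∀ (f : A → ℕ) xs ys → sum (map f (xs ++ ys)) ≡ sum (map f xs) + sum (map f ys)
  sum-map-++ f xs ys = trans (cong sum (map-++ f xs ys)) (sum-++ (map f xs) (map f ys))

  sum-map-cong : ∀ {f g : A → ℕ} → (∀ x → f x ≡ g x) → ∀ xs → sum (map f xs) ≡ sum (map g xs)
  sum-map-cong f≗g [] = refl
  sum-map-cong f≗g (x ∷ xs) = cong₂ _+_ (f≗g x) (sum-map-cong f≗g xs)

  sum-map-+ : ∀ (f g : A → ℕ) xs → sum (map (λ x → f x + g x) xs) ≡ sum (map f xs) + sum (map g xs)
  sum-map-+ f g [] = refl
  sum-map-+ f g (x ∷ xs) = trans (cong (f x + g x +_) (sum-map-+ f g xs)) (+-interchange (f x) (g x) _ _)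

  sum-map-* : ∀ a (f : A → ℕ) xs → sum (map (λ x → a * f x) xs) ≡ a * sum (map f xs)
  sum-map-* a f [] = sym (*-zeroʳ a)
  sum-map-* a f (x ∷ xs) = trans (cong (a * f x +_) (sum-map-* a f xs)) (sym (*-distribˡ-+ a (f x) _))

  sum-map-const : ∀ a (xs : List A) → sum (map (λ _ → a) xs) ≡ length xs * a
  sum-map-const a [] = refl
  sum-map-const a (x ∷ xs) = cong (a +_) (sum-map-const a xs)

  sum-map-concatMap-allFin : ∀ (f : A → ℕ) {n} (g : Fin n → List A) →
    sum (map f (concatMap g (allFin n))) ≡ ∑[ i < n ] sum (map f (g i))
  sum-map-concatMap-allFin f g = go g (λ i → i)
    where
    go : ∀ {m n} (g : Fin m → List A) (h : Fin n → Fin m) →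
      sum (map f (concatMap g (tabulate h))) ≡ ∑[ i < n ] sum (map f (g (h i)))
    go {n = zero} g h = refl
    go {n = suc n} g h = trans (sum-map-++ f (g (h zero)) _) (cong (sum (map f (g (h zero))) +_) (go g (h ∘ suc)))

  ∑-sum-map-comm : ∀ {k} (g : Fin k → A → ℕ) xs →
    ∑[ c < k ] sum (map (g c) xs) ≡ sum (map (λ x → ∑[ c < k ] g c x) xs)
  ∑-sum-map-comm {k = k} g [] = trans (∑-const k 0) (*-zeroʳ k)
  ∑-sum-map-comm {k = k} g (x ∷ xs) =
    trans (∑-distrib-+ (λ c → g c x) (λ c → sum (map (g c) xs))) (cong (∑[ c < k ] g c x +_) (∑-sum-map-comm g xs))

module _ {A : Set} (P : A → Bool) where

  hasSizeAndSatisfies : ℕ → (L : List A) → Vec Bool (length L) → Bool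
  hasSizeAndSatisfies m L v = (length (selected L v) ≡ᵇ m) ∧ and (map P (selected L v))

  count-subsets : ∀ m L →
    count (hasSizeAndSatisfies m L) (allVecs (true ∷ false ∷ []) (length L)) ≡ count P L C m
  count-subsets zero [] = refl
  count-subsets (suc m) [] = refl
  count-subsets m (x ∷ L) = begin
      count (hasSizeAndSatisfies m (x ∷ L)) (map (true ∷_) V ++ (map (false ∷_) V ++ []))
    ≡⟨ count-++ _ (map (true ∷_) V) _ ⟩
      count (hasSizeAndSatisfies m (x ∷ L)) (map (true ∷_) V)
        + count (hasSizeAndSatisfies m (x ∷ L)) (map (false ∷_) V ++ [])
    ≡⟨ cong₂ _+_ (count-map _ (true ∷_) V)
                 (trans (cong (count (hasSizeAndSatisfies m (x ∷ L))) (++-identityʳ (map (false ∷_) V)))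
                        (count-map _ (false ∷_) V)) ⟩
      count (hasSizeAndSatisfies m (x ∷ L) ∘ (true ∷_)) V + count (hasSizeAndSatisfies m L) V
    ≡⟨ cong₂ _+_ (count-containing-x m) (count-subsets m L) ⟩
      containing-x m + count P L C m
    ≡⟨ pascal-step m ⟩
      count P (x ∷ L) C m
    ∎
    where
    open ≡-Reasoning
    V = allVecs (true ∷ false ∷ []) (length L)
    containing-x : ℕ → ℕ
    containing-x zero = 0
    containing-x (suc m) = if P x then count P L C m else 0
    count-containing-x : ∀ m → count (hasSizeAndSatisfies m (x ∷ L) ∘ (true ∷_)) V ≡ containing-x m
    count-containing-x zero = count-false V
    count-containing-x (suc m) with P x
    ... | true  = count-subsets m L
    ... | false = trans (count-cong (λ v → ∧-zeroʳ _) V) (count-false V)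
    pascal-step : ∀ m → containing-x m + count P L C m ≡ count P (x ∷ L) C m
    pascal-step zero = refl
    pascal-step (suc m) with P x
    ... | true  = sym (pascal (count P L) m)
    ... | false = refl

-- Colourings

module _ {n k : ℕ} where

  bichromatic : Coloring n k → Fin n × Fin n → Bool
  bichromatic σ (i , j) = not (does (lookup σ i ≟ lookup σ j))

  #bichromatic : Coloring n k → ℕ
  #bichromatic σ = count (bichromatic σ) (allPairs n)

  |G|≡#bichromatic-C : ∀ m (σ : Coloring n k) → length (G n m σ) ≡ #bichromatic σ C m
  |G|≡#bichromatic-C m σ = trans
    (count-cong {p = λ g → (length (edges {n} g) ≡ᵇ m) ∧ isProper σ g} {q = hasSizeAndSatisfies (bichromatic σ) m (allPairs n)}
      (λ g → cong (λ ps → (length (edges {n} g) ≡ᵇ m) ∧ and ps) (map-cong (λ _ → refl) (edges {n} g))) (allGraphs n))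
    (count-subsets (bichromatic σ) m (allPairs n))

  #bichromatic≡∑∑ : ∀ (σ : Coloring n k) → #bichromatic σ ≡
    ∑[ i < n ] ∑[ j < n ] count (bichromatic σ) (if toℕ i <ᵇ toℕ j then (i , j) ∷ [] else [])
  #bichromatic≡∑∑ σ = trans (count-concatMap-allFin (bichromatic σ) {n} _)
    (sum-cong-≗ {n} (λ i → count-concatMap-allFin (bichromatic σ) {n} _))

#bichromatic-∷ : ∀ {n k} c (σ : Coloring n k) →
  #bichromatic (c ∷ σ) ≡ ∑[ j < n ] ⟦ not (does (c ≟ lookup σ j)) ⟧ + #bichromatic σ
#bichromatic-∷ {n} c σ = begin
    #bichromatic (c ∷ σ)
  ≡⟨ #bichromatic≡∑∑ (c ∷ σ) ⟩
    ∑[ j < n ] count (bichromatic (c ∷ σ)) ((zero , suc j) ∷ [])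
      + ∑[ i < n ] ∑[ j < n ] count (bichromatic (c ∷ σ)) (pairs (suc i) (suc j))
  ≡⟨ cong₂ _+_ (sum-cong-≗ (λ j → count-singleton (bichromatic (c ∷ σ)) (zero , suc j)))
               (sum-cong-≗ (λ i → sum-cong-≗ (λ j → shift i j))) ⟩
    ∑[ j < n ] ⟦ not (does (c ≟ lookup σ j)) ⟧
      + ∑[ i < n ] ∑[ j < n ] count (bichromatic σ) (pairs i j)
  ≡⟨ cong (∑[ j < n ] ⟦ not (does (c ≟ lookup σ j)) ⟧ +_) (sym (#bichromatic≡∑∑ σ)) ⟩
    ∑[ j < n ] ⟦ not (does (c ≟ lookup σ j)) ⟧ + #bichromatic σ
  ∎
  where
  open ≡-Reasoning
  pairs : ∀ {n} → Fin n → Fin n → List (Fin n × Fin n)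
  pairs i j = if toℕ i <ᵇ toℕ j then (i , j) ∷ [] else []
  shift : ∀ i j → count (bichromatic (c ∷ σ)) (pairs (suc i) (suc j)) ≡ count (bichromatic σ) (pairs i j)
  shift i j = go (toℕ i <ᵇ toℕ j)
    where
    go : ∀ b → count (bichromatic (c ∷ σ)) (if b then (suc i , suc j) ∷ [] else [])
             ≡ count (bichromatic σ) (if b then (i , j) ∷ [] else [])
    go true  = trans (count-singleton (bichromatic (c ∷ σ)) (suc i , suc j)) (sym (count-singleton (bichromatic σ) (i , j)))
    go false = refl

module _ {n k : ℕ} where

  classSize : Coloring n k → Fin k → ℕ
  classSize σ c = ∑[ j < n ] δ (lookup σ j) c

  sumOfSquares : Coloring n k → ℕ
  sumOfSquares σ = ∑[ c < k ] (classSize σ c * classSize σ c)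

∑-classSize : ∀ {n k} (σ : Coloring n k) → ∑[ c < k ] classSize σ c ≡ n
∑-classSize {k = k} [] = trans (∑-const k 0) (*-zeroʳ k)
∑-classSize {k = k} (d ∷ σ) = trans (∑-distrib-+ (δ d) (classSize σ)) (cong₂ _+_ (∑-δ d) (∑-classSize σ))

others+classSize : ∀ {n k} c (σ : Coloring n k) → ∑[ j < n ] ⟦ not (does (c ≟ lookup σ j)) ⟧ + classSize σ c ≡ n
others+classSize {n} c σ = begin
    ∑[ j < n ] ⟦ not (does (c ≟ lookup σ j)) ⟧ + classSize σ c
  ≡⟨ sym (∑-distrib-+ (λ j → ⟦ not (does (c ≟ lookup σ j)) ⟧) (λ j → δ (lookup σ j) c)) ⟩
    ∑[ j < n ] (⟦ not (does (c ≟ lookup σ j)) ⟧ + δ (lookup σ j) c)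
  ≡⟨ sum-cong-≗ {n} (λ j → ≢-indicator+δ c (lookup σ j)) ⟩
    ∑[ j < n ] 1
  ≡⟨ trans (∑-const n 1) (*-identityʳ n) ⟩
    n
  ∎
  where open ≡-Reasoning

sumOfSquares-∷ : ∀ {n k} d (σ : Coloring n k) → sumOfSquares (d ∷ σ) ≡ 1 + 2 * classSize σ d + sumOfSquares σ
sumOfSquares-∷ {k = k} d σ = begin
    ∑[ c < k ] ((δ d c + classSize σ c) * (δ d c + classSize σ c))
  ≡⟨ sum-cong-≗ {k} expand ⟩
    ∑[ c < k ] ((δ d c + 2 * (δ d c * classSize σ c)) + classSize σ c * classSize σ c)
  ≡⟨ ∑-distrib-+ (λ c → δ d c + 2 * (δ d c * classSize σ c)) _ ⟩
    ∑[ c < k ] (δ d c + 2 * (δ d c * classSize σ c)) + sumOfSquares σ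
  ≡⟨ cong (_+ sumOfSquares σ) (∑-distrib-+ (δ d) _) ⟩
    ∑[ c < k ] δ d c + ∑[ c < k ] (2 * (δ d c * classSize σ c)) + sumOfSquares σ
  ≡⟨ cong (λ x → x + sumOfSquares σ) (cong₂ _+_ (∑-δ d)
       (trans (sym (*-distribˡ-sum 2 (λ c → δ d c * classSize σ c))) (cong (2 *_) (∑-δ-* d (classSize σ))))) ⟩
    1 + 2 * classSize σ d + sumOfSquares σ
  ∎
  where
  open ≡-Reasoning
  square : ∀ a x → (a + x) * (a + x) ≡ (a * a + 2 * (a * x)) + x * x
  square = solve-∀
  expand : ∀ c → (δ d c + classSize σ c) * (δ d c + classSize σ c)
               ≡ (δ d c + 2 * (δ d c * classSize σ c)) + classSize σ c * classSize σ c
  expand c = trans (square (δ d c) (classSize σ c))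
                   (cong (λ x → x + 2 * (δ d c * classSize σ c) + classSize σ c * classSize σ c) (δ-idem d c))

2*#bichromatic+sumOfSquares≡n² : ∀ {n k} (σ : Coloring n k) → 2 * #bichromatic σ + sumOfSquares σ ≡ n * n
2*#bichromatic+sumOfSquares≡n² {k = k} [] = trans (∑-const k 0) (*-zeroʳ k)
2*#bichromatic+sumOfSquares≡n² {suc n} (d ∷ σ) = begin
    2 * #bichromatic (d ∷ σ) + sumOfSquares (d ∷ σ)
  ≡⟨ cong₂ (λ a b → 2 * a + b) (#bichromatic-∷ d σ) (sumOfSquares-∷ d σ) ⟩
    2 * (A + #bichromatic σ) + (1 + 2 * x + sumOfSquares σ)
  ≡⟨ regroup A (#bichromatic σ) x (sumOfSquares σ) ⟩
    2 * (A + x) + 1 + (2 * #bichromatic σ + sumOfSquares σ)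
  ≡⟨ cong₂ (λ a b → 2 * a + 1 + b) (others+classSize d σ) (2*#bichromatic+sumOfSquares≡n² σ) ⟩
    2 * n + 1 + n * n
  ≡⟨ square n ⟩
    suc n * suc n
  ∎
  where
  open ≡-Reasoning
  A = ∑[ j < n ] ⟦ not (does (d ≟ lookup σ j)) ⟧
  x = classSize σ d
  regroup : ∀ a f x q → 2 * (a + f) + (1 + 2 * x + q) ≡ 2 * (a + x) + 1 + (2 * f + q)
  regroup = solve-∀
  square : ∀ n → 2 * n + 1 + n * n ≡ (1 + n) * (1 + n)
  square = solve-∀

n²≤k*sumOfSquares : ∀ {n k} (σ : Coloring n k) → n * n ≤ k * sumOfSquares σ
n²≤k*sumOfSquares {n} {k} σ = subst (λ x → x * x ≤ k * sumOfSquares σ) (∑-classSize σ) (cauchy-schwarz (classSize σ))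

sum-allColorings-suc : ∀ n k (f : Coloring (suc n) k → ℕ) →
  sum (map f (allColorings (suc n) k)) ≡ ∑[ c < k ] sum (map (f ∘ (c ∷_)) (allColorings n k))
sum-allColorings-suc n k f = trans (sum-map-concatMap-allFin f (λ c → map (c ∷_) (allColorings n k)))
  (sum-cong-≗ {k} (λ c → cong sum (sym (map-∘ (allColorings n k)))))

length-allColorings : ∀ n k → length (allColorings n k) ≡ k ^ n
length-allColorings zero k = refl
length-allColorings (suc n) k = begin
    length (allColorings (suc n) k)
  ≡⟨ as-sum (allColorings (suc n) k) ⟩
    sum (map (λ _ → 1) (allColorings (suc n) k))
  ≡⟨ sum-allColorings-suc n k (λ _ → 1) ⟩
    ∑[ c < k ] sum (map (λ _ → 1) (allColorings n k))
  ≡⟨ sum-cong-≗ {k} (λ _ → trans (sym (as-sum (allColorings n k))) (length-allColorings n k)) ⟩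
    ∑[ c < k ] (k ^ n)
  ≡⟨ ∑-const k (k ^ n) ⟩
    k * k ^ n
  ∎
  where
  open ≡-Reasoning
  as-sum : ∀ {A : Set} (xs : List A) → length xs ≡ sum (map (λ _ → 1) xs)
  as-sum xs = sym (trans (sum-map-const 1 xs) (*-identityʳ (length xs)))

sum-classSize : ∀ n k → ∑[ c < k ] sum (map (λ σ → classSize σ c) (allColorings n k)) ≡ n * k ^ n
sum-classSize n k = begin
    ∑[ c < k ] sum (map (λ σ → classSize σ c) (allColorings n k))
  ≡⟨ ∑-sum-map-comm (λ c σ → classSize σ c) (allColorings n k) ⟩
    sum (map (λ σ → ∑[ c < k ] classSize σ c) (allColorings n k))
  ≡⟨ sum-map-cong ∑-classSize (allColorings n k) ⟩
    sum (map (λ _ → n) (allColorings n k))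
  ≡⟨ sum-map-const n (allColorings n k) ⟩
    length (allColorings n k) * n
  ≡⟨ trans (cong (_* n) (length-allColorings n k)) (*-comm (k ^ n) n) ⟩
    n * k ^ n
  ∎
  where open ≡-Reasoning

totalSumOfSquares : ℕ → ℕ → ℕ
totalSumOfSquares n k = sum (map sumOfSquares (allColorings n k))

totalSumOfSquares-suc : ∀ n k →
  totalSumOfSquares (suc n) k ≡ k * k ^ n + 2 * (n * k ^ n) + k * totalSumOfSquares n k
totalSumOfSquares-suc n k = begin
    totalSumOfSquares (suc n) k
  ≡⟨ sum-allColorings-suc n k sumOfSquares ⟩
    ∑[ c < k ] sum (map (λ σ → sumOfSquares (c ∷ σ)) Cs)
  ≡⟨ sum-cong-≗ {k} (λ c → sum-map-cong (sumOfSquares-∷ c) Cs) ⟩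
    ∑[ c < k ] sum (map (λ σ → 1 + 2 * classSize σ c + sumOfSquares σ) Cs)
  ≡⟨ sum-cong-≗ {k} split ⟩
    ∑[ c < k ] (k ^ n + 2 * sum (map (λ σ → classSize σ c) Cs) + Ψ)
  ≡⟨ trans (∑-distrib-+ {k} _ (λ _ → Ψ)) (cong₂ _+_ (∑-distrib-+ {k} (λ _ → k ^ n) _) (∑-const k Ψ)) ⟩
    ∑[ c < k ] (k ^ n) + ∑[ c < k ] (2 * sum (map (λ σ → classSize σ c) Cs)) + k * Ψ
  ≡⟨ cong (λ x → x + k * Ψ) (cong₂ _+_ (∑-const k (k ^ n))
       (trans (sym (*-distribˡ-sum {k} 2 _)) (cong (2 *_) (sum-classSize n k)))) ⟩
    k * k ^ n + 2 * (n * k ^ n) + k * Ψ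
  ∎
  where
  open ≡-Reasoning
  Cs = allColorings n k
  Ψ = totalSumOfSquares n k
  split : ∀ c → sum (map (λ σ → 1 + 2 * classSize σ c + sumOfSquares σ) Cs)
              ≡ k ^ n + 2 * sum (map (λ σ → classSize σ c) Cs) + Ψ
  split c = begin
      sum (map (λ σ → 1 + 2 * classSize σ c + sumOfSquares σ) Cs)
    ≡⟨ sum-map-+ (λ σ → 1 + 2 * classSize σ c) sumOfSquares Cs ⟩
      sum (map (λ σ → 1 + 2 * classSize σ c) Cs) + Ψ
    ≡⟨ cong (_+ Ψ) (sum-map-+ (λ _ → 1) (λ σ → 2 * classSize σ c) Cs) ⟩
      sum (map (λ _ → 1) Cs) + sum (map (λ σ → 2 * classSize σ c) Cs) + Ψ
    ≡⟨ cong (_+ Ψ) (cong₂ _+_ (trans (sum-map-const 1 Cs) (trans (*-identityʳ _) (length-allColorings n k)))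
                              (sum-map-* 2 (λ σ → classSize σ c) Cs)) ⟩
      k ^ n + 2 * sum (map (λ σ → classSize σ c) Cs) + Ψ
    ∎

-- k E[Q] = n (n + k - 1), in a form free of subtraction and division.
totalSumOfSquares-closed : ∀ n k → k * totalSumOfSquares n k + k ^ n * n ≡ k ^ n * n * (n + k)
totalSumOfSquares-closed zero k =
  trans (cong (λ x → k * x + 0) (trans (+-identityʳ _) (trans (∑-const k 0) (*-zeroʳ k)))) (cong (_+ 0) (*-zeroʳ k))
totalSumOfSquares-closed (suc n) k = +-cancelʳ-≡ (k * (K * n)) _ _ (begin
    k * totalSumOfSquares (suc n) k + k * K * suc n + k * (K * n)
  ≡⟨ cong (λ z → k * z + k * K * suc n + k * (K * n)) (totalSumOfSquares-suc n k) ⟩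
    k * (k * K + 2 * (n * K) + k * Ψ) + k * K * suc n + k * (K * n)
  ≡⟨ regroup k K n Ψ ⟩
    k * (k * K + 2 * (n * K)) + k * K * suc n + k * (k * Ψ + K * n)
  ≡⟨ cong (λ z → k * (k * K + 2 * (n * K)) + k * K * suc n + k * z) (totalSumOfSquares-closed n k) ⟩
    k * (k * K + 2 * (n * K)) + k * K * suc n + k * (K * n * (n + k))
  ≡⟨ expand k K n ⟩
    k * K * suc n * (suc n + k) + k * (K * n)
  ∎)
  where
  open ≡-Reasoning
  K = k ^ n
  Ψ = totalSumOfSquares n k
  regroup : ∀ k K n P → k * (k * K + 2 * (n * K) + k * P) + k * K * suc n + k * (K * n)
                      ≡ k * (k * K + 2 * (n * K)) + k * K * suc n + k * (k * P + K * n)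
  regroup = solve-∀
  expand : ∀ k K n → k * (k * K + 2 * (n * K)) + k * K * suc n + k * (K * n * (n + k))
                   ≡ k * K * suc n * (suc n + k) + k * (K * n)
  expand = solve-∀

module _ {n k′ : ℕ} where

  -- The subtraction never truncates, by n²≤k*sumOfSquares.
  excess : Coloring n (suc k′) → ℕ
  excess σ = suc k′ * sumOfSquares σ ∸ n * n

  isBalanced : Coloring n (suc k′) → Bool
  isBalanced σ = not (2 * n * k′ ≤ᵇ excess σ)

  sum-excess : sum (map excess (allColorings n (suc k′))) ≡ suc k′ ^ n * n * k′
  sum-excess = +-cancelʳ-≡ (K * (n * n) + K * n) _ _ (begin
      sum (map excess Cs) + (K * (n * n) + K * n)
    ≡⟨ sym (+-assoc (sum (map excess Cs)) _ _) ⟩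
      sum (map excess Cs) + K * (n * n) + K * n
    ≡⟨ cong (λ z → sum (map excess Cs) + z + K * n)
         (sym (trans (sum-map-const (n * n) Cs) (cong (_* (n * n)) (length-allColorings n k)))) ⟩
      sum (map excess Cs) + sum (map (λ _ → n * n) Cs) + K * n
    ≡⟨ cong (_+ K * n) (sym (sum-map-+ excess (λ _ → n * n) Cs)) ⟩
      sum (map (λ σ → excess σ + n * n) Cs) + K * n
    ≡⟨ cong (_+ K * n) (sum-map-cong (λ σ → m∸n+n≡m (n²≤k*sumOfSquares σ)) Cs) ⟩
      sum (map (λ σ → k * sumOfSquares σ) Cs) + K * n
    ≡⟨ cong (_+ K * n) (sum-map-* k sumOfSquares Cs) ⟩
      k * totalSumOfSquares n k + K * n
    ≡⟨ totalSumOfSquares-closed n k ⟩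
      K * n * (n + k)
    ≡⟨ expand K n k′ ⟩
      K * n * k′ + (K * (n * n) + K * n)
    ∎)
    where
    open ≡-Reasoning
    k = suc k′
    K = k ^ n
    Cs = allColorings n k
    expand : ∀ K n k′ → K * n * (n + suc k′) ≡ K * n * k′ + (K * (n * n) + K * n)
    expand = solve-∀

  count-unbalanced : 1 ≤ n → 1 ≤ k′ →
    2 * count (λ σ → 2 * n * k′ ≤ᵇ excess σ) (allColorings n (suc k′)) ≤ suc k′ ^ n
  count-unbalanced n≥1 k′≥1 = *-cancelʳ-≤ _ _ (n * k′) {{>-nonZero (*-mono-≤ n≥1 k′≥1)}} (begin
      2 * B * (n * k′)            ≡⟨ regroup B n k′ ⟩
      B * (2 * n * k′)            ≤⟨ markov excess (2 * n * k′) (allColorings n (suc k′)) ⟩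
      sum (map excess (allColorings n (suc k′)))   ≡⟨ sum-excess ⟩
      suc k′ ^ n * n * k′         ≡⟨ *-assoc (suc k′ ^ n) n k′ ⟩
      suc k′ ^ n * (n * k′)       ∎)
    where
    open ≤-Reasoning
    B = count (λ σ → 2 * n * k′ ≤ᵇ excess σ) (allColorings n (suc k′))
    regroup : ∀ c n k′ → 2 * c * (n * k′) ≡ c * (2 * n * k′)
    regroup = solve-∀

  count-balanced : 1 ≤ n → 1 ≤ k′ → suc k′ ^ n ≤ 2 * count isBalanced (allColorings n (suc k′))
  count-balanced n≥1 k′≥1 = +-cancelˡ-≤ (2 * B) _ _ (begin
      2 * B + K              ≤⟨ +-monoˡ-≤ K (count-unbalanced n≥1 k′≥1) ⟩
      K + K                  ≡⟨ cong (K +_) (sym (+-identityʳ K)) ⟩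
      2 * K                  ≡⟨ cong (2 *_) (sym (trans (count+count-not _ Cs) (length-allColorings n (suc k′)))) ⟩
      2 * (B + count isBalanced Cs)   ≡⟨ *-distribˡ-+ 2 B _ ⟩
      2 * B + 2 * count isBalanced Cs ∎)
    where
    open ≤-Reasoning
    K = suc k′ ^ n
    Cs = allColorings n (suc k′)
    B = count (λ σ → 2 * n * k′ ≤ᵇ excess σ) Cs

  #bichromatic-upper : ∀ (τ : Coloring n (suc k′)) → 2 * suc k′ * #bichromatic τ ≤ k′ * (n * n)
  #bichromatic-upper τ = +-cancelʳ-≤ (n * n) _ _ (begin
      2 * k * F + n * n          ≤⟨ +-monoʳ-≤ (2 * k * F) (n²≤k*sumOfSquares τ) ⟩
      2 * k * F + k * Q          ≡⟨ factor k F Q ⟩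
      k * (2 * F + Q)            ≡⟨ cong (k *_) (2*#bichromatic+sumOfSquares≡n² τ) ⟩
      k * (n * n)                ≡⟨ +-comm (n * n) (k′ * (n * n)) ⟩
      k′ * (n * n) + n * n       ∎)
    where
    open ≤-Reasoning
    k = suc k′
    F = #bichromatic τ
    Q = sumOfSquares τ
    factor : ∀ k F Q → 2 * k * F + k * Q ≡ k * (2 * F + Q)
    factor = solve-∀

  #bichromatic-lower : ∀ (σ : Coloring n (suc k′)) → T (isBalanced σ) →
    k′ * (n * n) < 2 * suc k′ * #bichromatic σ + 2 * n * k′
  #bichromatic-lower σ balanced = +-cancelʳ-< (n * n) _ _ (begin-strict
      k′ * (n * n) + n * n            ≡⟨ +-comm (k′ * (n * n)) (n * n) ⟩
      k * (n * n)                     ≡⟨ cong (k *_) (sym (2*#bichromatic+sumOfSquares≡n² σ)) ⟩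
      k * (2 * F + Q)                 ≡⟨ *-distribˡ-+ k (2 * F) Q ⟩
      k * (2 * F) + k * Q             <⟨ +-monoʳ-< (k * (2 * F)) kQ< ⟩
      k * (2 * F) + (n * n + 2 * n * k′)   ≡⟨ regroup k F (n * n) (2 * n * k′) ⟩
      2 * k * F + 2 * n * k′ + n * n  ∎)
    where
    open ≤-Reasoning
    k = suc k′
    F = #bichromatic σ
    Q = sumOfSquares σ
    excess< : excess σ < 2 * n * k′
    excess< = not-≤ᵇ⇒> balanced
    kQ< : k * Q < n * n + 2 * n * k′
    kQ< = begin-strict
      k * Q                   ≡⟨ sym (m∸n+n≡m (n²≤k*sumOfSquares σ)) ⟩
      excess σ + n * n        <⟨ +-monoˡ-< (n * n) excess< ⟩
      2 * n * k′ + n * n      ≡⟨ +-comm (2 * n * k′) (n * n) ⟩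
      n * n + 2 * n * k′      ∎
    regroup : ∀ k F a b → k * (2 * F) + (a + b) ≡ 2 * k * F + b + a
    regroup = solve-∀

  #bichromatic-near-max : ∀ σ → T (isBalanced σ) → ∀ τ → #bichromatic τ < #bichromatic σ + n
  #bichromatic-near-max σ balanced τ = *-cancelˡ-< (2 * suc k′) _ _ (begin-strict
      2 * suc k′ * #bichromatic τ                  ≤⟨ #bichromatic-upper τ ⟩
      k′ * (n * n)                                 <⟨ #bichromatic-lower σ balanced ⟩
      2 * suc k′ * #bichromatic σ + 2 * n * k′     ≤⟨ +-monoʳ-≤ _ (*-monoʳ-≤ (2 * n) (n≤1+n k′)) ⟩
      2 * suc k′ * #bichromatic σ + 2 * n * suc k′ ≡⟨ factor (suc k′) (#bichromatic σ) n ⟩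
      2 * suc k′ * (#bichromatic σ + n)            ∎)
    where
    open ≤-Reasoning
    factor : ∀ k F n → 2 * k * F + 2 * n * k ≡ 2 * k * (F + n)
    factor = solve-∀

  #bichromatic-large : ∀ {p m w} σ → T (isBalanced σ) → 1 ≤ k′ → m ≤ p * n → 1 ≤ w → 8 * suc p * w ≤ n →
    2 * (m * w) < #bichromatic σ
  #bichromatic-large {p} {m} {w} σ balanced k′≥1 m≤pn w≥1 8[1+p]w≤n =
    *-cancelˡ-< (2 * suc k′) _ _ (+-cancelʳ-< (2 * n * k′) _ _ (begin-strict
      2 * suc k′ * (2 * (m * w)) + 2 * n * k′      ≤⟨ +-monoˡ-≤ (2 * n * k′) lhs≤ ⟩
      8 * k′ * p * n * w + 2 * n * k′              ≡⟨ factor k′ p n w ⟩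
      k′ * n * (8 * p * w + 2)                     ≤⟨ *-monoʳ-≤ (k′ * n) 8pw+2≤n ⟩
      k′ * n * n                                   ≡⟨ *-assoc k′ n n ⟩
      k′ * (n * n)                                 <⟨ #bichromatic-lower σ balanced ⟩
      2 * suc k′ * #bichromatic σ + 2 * n * k′     ∎))
    where
    open ≤-Reasoning
    1+k′≤2k′ : suc k′ ≤ 2 * k′
    1+k′≤2k′ = subst (suc k′ ≤_) (cong (k′ +_) (sym (+-identityʳ k′))) (≤-trans (≤-reflexive (+-comm 1 k′)) (+-monoʳ-≤ k′ k′≥1))
    lhs≤ : 2 * suc k′ * (2 * (m * w)) ≤ 8 * k′ * p * n * w
    lhs≤ = begin
        2 * suc k′ * (2 * (m * w))         ≤⟨ *-mono-≤ (*-monoʳ-≤ 2 1+k′≤2k′) (*-monoʳ-≤ 2 (*-monoˡ-≤ w m≤pn)) ⟩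
        2 * (2 * k′) * (2 * (p * n * w))   ≡⟨ regroup k′ p n w ⟩
        8 * k′ * p * n * w                 ∎
      where
      regroup : ∀ k p n w → 2 * (2 * k) * (2 * (p * n * w)) ≡ 8 * k * p * n * w
      regroup = solve-∀
    factor : ∀ k p n w → 8 * k * p * n * w + 2 * n * k ≡ k * n * (8 * p * w + 2)
    factor = solve-∀
    8pw+2≤n : 8 * p * w + 2 ≤ n
    8pw+2≤n = ≤-trans (+-monoʳ-≤ (8 * p * w) (≤-trans (s≤s (s≤s z≤n)) (*-monoʳ-≤ 8 w≥1)))
                      (subst (_≤ n) (expand p w) 8[1+p]w≤n)
      where
      expand : ∀ p w → 8 * suc p * w ≡ 8 * p * w + 8 * w
      expand = solve-∀

|G|-balanced-near-max : ∀ {n k′} p m → 1 ≤ k′ → m ≤ p * n → 8 * suc p ≤ n →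
  ∀ (σ τ : Coloring n (suc k′)) → T (isBalanced σ) →
  length (G n m τ) ≤ 2 ^ (2 * (8 * suc p)) * length (G n m σ)
|G|-balanced-near-max {n} p m k′≥1 m≤pn d≤n σ τ balanced
  rewrite |G|≡#bichromatic-C m σ | |G|≡#bichromatic-C m τ
  with #bichromatic τ ≤? #bichromatic σ
... | yes Fτ≤Fσ = ≤-trans (C-monoˡ m Fτ≤Fσ) (m≤n*m _ (2 ^ J) {{m^n≢0 2 J}})
  where J = 2 * (8 * suc p)
... | no Fτ≰Fσ = begin
    #bichromatic τ C m          ≡⟨ cong (_C m) (sym (m+[n∸m]≡n Fσ≤Fτ)) ⟩
    (Fσ + t) C m                ≤⟨ C-growth J w t Fσ m (<⇒≤ (#bichromatic-large {p = p} σ balanced k′≥1 m≤pn w≥1 dw≤n)) t≤Jw ⟩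
    2 ^ J * (Fσ C m)            ∎
  where
  open ≤-Reasoning
  d = 8 * suc p
  J = 2 * d
  w = n / d
  Fσ = #bichromatic σ
  Fσ≤Fτ = <⇒≤ (≰⇒> Fτ≰Fσ)
  t = #bichromatic τ ∸ Fσ
  w≥1 : 1 ≤ w
  w≥1 = m≥n⇒m/n>0 d≤n
  dw≤n : d * w ≤ n
  dw≤n = subst (_≤ n) (*-comm w d) (m/n*n≤m n d)
  t≤Jw : t ≤ J * w
  t≤Jw = begin
    t                ≤⟨ <⇒≤ (+-cancelˡ-< Fσ t n (subst (_< Fσ + n) (sym (m+[n∸m]≡n Fσ≤Fτ)) (#bichromatic-near-max σ balanced τ))) ⟩
    n                ≤⟨ m≤2*[m/n]*n n d d≤n ⟩
    2 * w * d        ≡⟨ *-comm-3 2 w d ⟩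
    J * w            ∎
    where
    *-comm-3 : ∀ a b c → a * b * c ≡ a * c * b
    *-comm-3 = solve-∀

edgeCount≤ : ∀ p q n → edgeCount p q n ≤ p * n
edgeCount≤ p zero n = z≤n
edgeCount≤ p (suc q) n = m/n≤m (p * n) (2 * suc q)

ρ⁻¹ : ℕ → ℕ → ℕ
ρ⁻¹ k p = 2 ^ (2 * (8 * suc p)) * k ^ (8 * suc p)

module _ (k′ p n m : ℕ) where

  private
    k = suc k′
    d = 8 * suc p
    s = ρ⁻¹ k p
    Cs = allColorings n k
    s≢0 : NonZero s
    s≢0 = m*n≢0 (2 ^ (2 * d)) (k ^ d) {{m^n≢0 2 (2 * d)}} {{m^n≢0 k d}}
    good : Coloring n k → Bool
    good σ = 1 * Λ n k m ≤ᵇ s * length (G n m σ)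
    2^2d≤s : 2 ^ (2 * d) ≤ s
    2^2d≤s = m≤m*n (2 ^ (2 * d)) (k ^ d) {{m^n≢0 k d}}
    good⇐ : ∀ σ → Λ n k m ≤ s * length (G n m σ) → T (good σ)
    good⇐ σ = ≤⇒≤ᵇ ∘ subst (_≤ s * length (G n m σ)) (sym (*-identityˡ _))
    open ≤-Reasoning

  many-good-colorings : 1 ≤ k′ → m ≤ p * n → suc k′ ^ n ≤ ρ⁻¹ (suc k′) p * goodCount n (suc k′) m 1 (ρ⁻¹ (suc k′) p)
  many-good-colorings k′≥1 m≤pn
    with foldr-selective ⊔-sel 0 (map (λ σ → length (G n m σ)) Cs)
  ... | inj₁ Λ≡0 = begin
      k ^ n                    ≤⟨ m≤n*m (k ^ n) s {{s≢0}} ⟩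
      s * k ^ n                ≡⟨ cong (s *_) (sym (trans (count-all everyone-good Cs) (length-allColorings n k))) ⟩
      s * count good Cs        ∎
    where
    everyone-good : ∀ σ → T (good σ)
    everyone-good σ = good⇐ σ (subst (_≤ s * length (G n m σ)) (sym Λ≡0) z≤n)
  ... | inj₂ Λ∈ with ∈-map⁻ (λ σ → length (G n m σ)) Λ∈
  ... | τ , τ∈ , Λ≡|Gτ| with n <? d
  ...   | yes n<d = begin
      k ^ n                    ≤⟨ ^-monoʳ-≤ k (<⇒≤ n<d) ⟩
      k ^ d                    ≤⟨ m≤n*m (k ^ d) (2 ^ (2 * d)) {{m^n≢0 2 (2 * d)}} ⟩
      s                        ≡⟨ sym (*-identityʳ s) ⟩
      s * 1                    ≤⟨ *-monoʳ-≤ s (count-∈ τ∈ τ-good) ⟩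
      s * count good Cs        ∎
    where
    τ-good : T (good τ)
    τ-good = good⇐ τ (subst (_≤ s * length (G n m τ)) (sym Λ≡|Gτ|) (m≤n*m _ s {{s≢0}}))
  ...   | no n≮d = begin
      k ^ n                          ≤⟨ count-balanced (≤-trans (s≤s z≤n) d≤n) k′≥1 ⟩
      2 * count isBalanced Cs        ≤⟨ *-monoʳ-≤ 2 (count-mono balanced⇒good Cs) ⟩
      2 * count good Cs              ≤⟨ *-monoˡ-≤ _ 2≤s ⟩
      s * count good Cs              ∎
    where
    d≤n = ≮⇒≥ n≮d
    balanced⇒good : ∀ σ → T (isBalanced σ) → T (good σ)
    balanced⇒good σ balanced = good⇐ σ (subst (_≤ s * length (G n m σ)) (sym Λ≡|Gτ|)
      (≤-trans (|G|-balanced-near-max p m k′≥1 m≤pn d≤n σ τ balanced) (*-monoˡ-≤ _ 2^2d≤s)))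
    2≤s : 2 ≤ s
    2≤s = ≤-trans (*-monoʳ-≤ 2 (m^n>0 2 (pred (2 * d)))) 2^2d≤s

lemma5 : (a b : ℕ) → 0 < a → 0 < b →
    Σ ℕ (λ k₀ → (k : ℕ) → k₀ ≤ k → (p q : ℕ) → 0 < q → DegreeBound a b p q k →
    Σ ℕ (λ r → Σ ℕ (λ s → 0 < r × 0 < s ×
    ((n : ℕ) → r * k ^ n ≤ s * goodCount n k (edgeCount p q n) r s))))
lemma5 _ _ _ _ = 2 , λ where
  (suc k′) (s≤s k′≥1) p q _ _ →
    1 , ρ⁻¹ (suc k′) p , s≤s z≤n , *-mono-≤ (m^n>0 2 (2 * (8 * suc p))) (m^n>0 (suc k′) (8 * suc p)) , λ n →
      ≤-trans (≤-reflexive (*-identityˡ _)) (many-good-colorings k′ p n (edgeCount p q n) k′≥1 (edgeCount≤ p q n))
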